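{- Let $\pi\in S_n$ and $S\in\mathrm{Sub}(\pi)$. If $S$ is horizontally separated, then $S$ is valid. In particular, $\left|\mathcal{O}^{ -1}_{\mathrm{MVP}_n}(\pi)\right|\ge|\{S\in\mathrm{Sub}(\pi): S\text{ is horizontally separated}\}|$.
   Context: Let $[n]=\{1,\dots,n\}$. A parking preference is $p\in[n]^n$. In the MVP parking process, cars $1,\dots,n$ enter in order a one-way street with spots $1,\dots,n$; car $i$ parks in spot $p_i$, and if $p_i$ was occupied by an earlier car $j$, car $j$ is bumped and parks in the first unoccupied spot $k>p_i$ (bumped cars do not bump others). $p$ is an MVP parking function if all cars park; $\mathrm{MVP}_n$ is the set of these. The outcome $\mathcal{O}_{\mathrm{MVP}_n}(p)$ is the permutation $\pi$ with $\pi_i$ the car in spot $i$ at the end; $\mathcal{O}^{ -1}_{\mathrm{MVP}_n}(\pi)$ is the set of MVP parking functions with outcome $\pi$. $\mathrm{Inv}(\pi)=\{(j,i):j<i,\ \pi_j>\pi_i\}$; $\mathrm{Sub}(\pi)$ is the set of $S\subseteq\mathrm{Inv}(\pi)$ such that each $i$ has at most one $j$ with $(j,i)\in S$. For $S\in\mathrm{Sub}(\pi)$, $\Psi_{\mathrm{Sub}\to\mathrm{PF}}(S)$ is the preference $p$ with $p_{\pi_i}=i$ if no $(j,i)\in S$ and $p_{\pi_i}=j$ if $(j,i)\in S$; $S$ is valid if $\mathcal{O}_{\mathrm{MVP}_n}(\Psi_{\mathrm{Sub}\to\mathrm{PF}}(S))=\pi$. $S$ is horizontally separated if for any two distinct edges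 $(j,i),(j',i')\in S$ (with $j<i$, $j'<i'$) we have $i<j'$ or $i'<j$. -}

module Defs where

-- Conventions: everything is 0-indexed.  Cars and spots are elements of Fin n
-- (car c / spot s of the paper is Fin element c-1 / s-1).

open import Data.Nat using (ℕ; zero; suc)
open import Data.Bool using (Bool; true; false)
open import Data.Bool.Properties using () renaming (_≟_ to _≟ᵇ_)
open import Data.Fin using (Fin; _<_; _<?_; _≟_)
open import Data.Fin.Properties using (all?)
open import Data.Fin.Permutation using (Permutation′; _⟨$⟩ʳ_; _⟨$⟩ˡ_)
open import Data.Maybe using (Maybe; just; nothing; _>>=_)
import Data.Maybe.Properties as MaybeP
open import Data.Vec using (Vec; []; _∷_; lookup; tabulate; _[_]≔_)
import Data.Vec.Properties as VecP
open import Data.List using (List; []; _∷_; [_]; filter; allFin; foldl; head; concatMap; map)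
open import Data.Product using (_×_; _,_)
open import Data.Sum using (_⊎_)
open import Relation.Binary.PropositionalEquality using (_≡_; _≢_)
open import Relation.Nullary using (Dec; ¬?)
open import Relation.Nullary.Decidable using (_×-dec_; _⊎-dec_; _→-dec_)

-- A street: for every spot, the car parked there (if any).
Street : ℕ → Set
Street n = Vec (Maybe (Fin n)) n

emptyStreet : ∀ {n} → Street n
emptyStreet = tabulate (λ _ → nothing)

firstFreeAfter : ∀ {n} → Street n → Fin n → Maybe (Fin n)
firstFreeAfter {n} st a =
  head (filter (λ k → (a <? k) ×-dec MaybeP.≡-dec _≟_ (lookup st k) nothing) (allFin n))

step : ∀ {n} → Street n → Fin n → Fin n → Maybe (Street n)
step st i a with lookup st a
... | nothing = just (st [ a ]≔ just i)
... | just j with firstFreeAfter st a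
...   | nothing = nothing
...   | just k = just ((st [ a ]≔ just i) [ k ]≔ just j)

runMVP : ∀ {n} → Vec (Fin n) n → Maybe (Street n)
runMVP {n} p = foldl (λ ms i → ms >>= λ st → step st i (lookup p i)) (just emptyStreet) (allFin n)

-- O_MVP(p) = π : all cars park, and at the end spot s holds car π_s.
-- (In particular p is then an MVP parking function.)
HasOutcome : ∀ {n} → Vec (Fin n) n → Permutation′ n → Set
HasOutcome {n} p π = runMVP p ≡ just (tabulate (λ s → just (π ⟨$⟩ʳ s)))

hasOutcome? : ∀ {n} (p : Vec (Fin n) n) (π : Permutation′ n) → Dec (HasOutcome p π)
hasOutcome? p π = MaybeP.≡-dec (VecP.≡-dec (MaybeP.≡-dec _≟_)) (runMVP p) _

-- A set S of pairs (j , i) of positions, given by its characteristic matrix.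
PairSet : ℕ → Set
PairSet n = Vec (Vec Bool n) n

_∋_,_ : ∀ {n} → PairSet n → Fin n → Fin n → Set
S ∋ j , i = lookup (lookup S j) i ≡ true

infix 4 _∋_,_

_∋?_,_ : ∀ {n} (S : PairSet n) (j i : Fin n) → Dec (S ∋ j , i)
S ∋? j , i = lookup (lookup S j) i ≟ᵇ true

InSub : ∀ {n} → Permutation′ n → PairSet n → Set
InSub π S =
  (∀ j i → S ∋ j , i → (j < i) × (π ⟨$⟩ʳ i < π ⟨$⟩ʳ j)) ×
  (∀ i j j′ → S ∋ j , i → S ∋ j′ , i → j ≡ j′)

inSub? : ∀ {n} (π : Permutation′ n) (S : PairSet n) → Dec (InSub π S)
inSub? π S =
  all? (λ j → all? (λ i → (S ∋? j , i) →-dec ((j <? i) ×-dec (π ⟨$⟩ʳ i <? π ⟨$⟩ʳ j))))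
  ×-dec
  all? (λ i → all? (λ j → all? (λ j′ → (S ∋? j , i) →-dec ((S ∋? j′ , i) →-dec (j ≟ j′)))))

HorizSep : ∀ {n} → PairSet n → Set
HorizSep S = ∀ j i j′ i′ → S ∋ j , i → S ∋ j′ , i′ →
  (j ≢ j′ ⊎ i ≢ i′) → (i < j′ ⊎ i′ < j)

horizSep? : ∀ {n} (S : PairSet n) → Dec (HorizSep S)
horizSep? S =
  all? λ j → all? λ i → all? λ j′ → all? λ i′ →
    (S ∋? j , i) →-dec ((S ∋? j′ , i′) →-dec
      ((¬? (j ≟ j′) ⊎-dec ¬? (i ≟ i′)) →-dec ((i <? j′) ⊎-dec (i′ <? j))))

-- the (unique, for S ∈ Sub(π)) j with (j,i) ∈ S, if any
sourceOf : ∀ {n} → PairSet n → Fin n → Maybe (Fin n)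
sourceOf {n} S i = head (filter (λ j → S ∋? j , i) (allFin n))

-- Ψ_{Sub→PF}(S): p_{π_i} = j if (j,i) ∈ S, and p_{π_i} = i otherwise.
Ψ : ∀ {n} → Permutation′ n → PairSet n → Vec (Fin n) n
Ψ π S = tabulate (λ c → pick (π ⟨$⟩ˡ c) (sourceOf S (π ⟨$⟩ˡ c)))
  where
  pick : ∀ {n} → Fin n → Maybe (Fin n) → Fin n
  pick i nothing  = i
  pick i (just j) = j

Valid : ∀ {n} → Permutation′ n → PairSet n → Set
Valid π S = HasOutcome (Ψ π S) π

allVecs : ∀ {a} {A : Set a} → List A → (k : ℕ) → List (Vec A k)
allVecs xs zero    = [ [] ]
allVecs xs (suc k) = concatMap (λ x → map (x ∷_) (allVecs xs k)) xs

allPreferences : (n : ℕ) → List (Vec (Fin n) n)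
allPreferences n = allVecs (allFin n) n

allPairSets : (n : ℕ) → List (PairSet n)
allPairSets n = allVecs (allVecs (true ∷ false ∷ []) n) n

-- Under Ψ π S the car that ends in spot i prefers spot j when (j , i) ∈ S and spot i otherwise,
-- and horizontal separation makes the intervals [j , i] of the edges pairwise disjoint.  The car
-- of i enters before the car of j, finds j empty and parks there.  From then on it sits at the
-- first spot of [j , i] whose own car has not entered yet: when that car arrives it bumps the car
-- of i, which passes the spots already filled and stops at the next one still empty.  So the car
-- of i reaches i when the last car of [j , i] has entered, while every other car parks directly in
-- its final spot.  Counting follows because Ψ π is injective on Sub(π).
module Submission where

open import Defs
open import Data.Nat using (ℕ; _≤_)
open import Data.Fin.Permutation using (Permutation′)
open import Data.List using (length; filter)
open import Data.Product using (_×_)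
open import Relation.Nullary.Decidable using (_×-dec_)

open import Data.Bool using (Bool; true; false)
open import Data.Empty using (⊥; ⊥-elim)
open import Data.Fin as F using (Fin; toℕ)
import Data.Fin.Properties as FP
open import Data.Fin.Permutation using (_⟨$⟩ʳ_; _⟨$⟩ˡ_; inverseˡ; inverseʳ)
open import Data.List as L using (List; []; _∷_; head; allFin; cartesianProductWith)
import Data.List.Properties as L
open import Data.List.Membership.Propositional using (_∈_)
open import Data.List.Membership.Propositional.Properties
  using (∈-allFin; ∈-map⁻; ∈-filter⁺; ∈-filter⁻; ∈-∃++; ∈-++⁻; ∈-++⁺ˡ; ∈-++⁺ʳ;
         ∈-cartesianProductWith⁺)
open import Data.List.Relation.Binary.Subset.Propositional using (_⊆_)
open import Data.List.Relation.Unary.All as All using ([]; _∷_)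
import Data.List.Relation.Unary.All.Properties as All
open import Data.List.Relation.Unary.AllPairs using ([]; _∷_)
open import Data.List.Relation.Unary.Any using (here; there)
open import Data.List.Relation.Unary.Unique.Propositional using (Unique)
import Data.List.Relation.Unary.Unique.Propositional.Properties as Unique
open import Data.Maybe using (Maybe; just; nothing; fromMaybe; _>>=_)
open import Data.Nat using (zero; suc; _+_; _<_; z≤n; s≤s)
import Data.Nat.Properties as ℕ
open import Data.Product using (∃; ∃₂; _,_; proj₁; proj₂)
open import Data.Sum using (_⊎_; inj₁; inj₂)
open import Data.Vec as V using (Vec; lookup; tabulate; _[_]≔_)
import Data.Vec.Properties as V
open import Function.Base using (_∘_)
open import Function.Bundles using (Injection)
open import Function.Properties.Inverse using (↔⇒↣)
open import Relation.Binary using (tri<; tri≈; tri>)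
open import Relation.Binary.PropositionalEquality
  using (_≡_; _≢_; refl; sym; trans; cong; subst; ≢-sym)
open import Relation.Nullary using (¬_; Dec; yes; no)
open import Relation.Unary using (Pred; Decidable)

module _ {a p} {A : Set a} {P : Pred A p} (P? : Decidable P) where

  head-filter≡nothing⇒∀¬ : ∀ xs → head (filter P? xs) ≡ nothing → ∀ {x} → x ∈ xs → ¬ P x
  head-filter≡nothing⇒∀¬ (y ∷ xs) eq x∈ px with P? y
  head-filter≡nothing⇒∀¬ (y ∷ xs) () x∈ px | yes _
  ... | no ¬py with x∈
  ...   | here refl = ¬py px
  ...   | there x∈xs = head-filter≡nothing⇒∀¬ xs eq x∈xs px

  head-filter-tabulate≡just⇒least : ∀ {m} (g : Fin m → A) {x} →
    head (filter P? (L.tabulate g)) ≡ just x →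
    ∃ λ i → g i ≡ x × P x × (∀ i′ → i′ F.< i → ¬ P (g i′))
  head-filter-tabulate≡just⇒least {zero} g ()
  head-filter-tabulate≡just⇒least {suc m} g eq with P? (g F.zero)
  head-filter-tabulate≡just⇒least {suc m} g refl | yes px = F.zero , refl , px , λ _ ()
  ... | no ¬p with head-filter-tabulate≡just⇒least (λ i → g (F.suc i)) eq
  ...   | i , gi≡x , px , least = F.suc i , gi≡x , px , λ where
          F.zero _ → ¬p
          (F.suc i′) (s≤s i′<i) → least i′ i′<i

module _ {m p} {P : Pred (Fin m) p} (P? : Decidable P) where

  head-filter-allFin≡nothing⇒∄ : head (filter P? (allFin m)) ≡ nothing → ∀ x → ¬ P x
  head-filter-allFin≡nothing⇒∄ eq x = head-filter≡nothing⇒∀¬ P? (allFin m) eq (∈-allFin x)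

  head-filter-allFin≡just⇒least : ∀ {x} → head (filter P? (allFin m)) ≡ just x →
                                   P x × (∀ y → y F.< x → ¬ P y)
  head-filter-allFin≡just⇒least eq with head-filter-tabulate≡just⇒least P? (λ i → i) eq
  ... | _ , refl , px , least = px , least

length-≤-of-Unique-⊆ : ∀ {a} {A : Set a} {xs ys : List A} → Unique xs → xs ⊆ ys →
                       length xs ≤ length ys
length-≤-of-Unique-⊆ {xs = []} _ _ = z≤n
length-≤-of-Unique-⊆ {xs = x ∷ xs} {ys} (x∉xs ∷ unique) xs⊆ys with ∈-∃++ (xs⊆ys (here refl))
... | us , vs , refl = begin
  suc (length xs)             ≤⟨ s≤s (length-≤-of-Unique-⊆ unique xs⊆us++vs) ⟩
  suc (length (us L.++ vs))   ≡⟨ cong suc (L.length-++ us) ⟩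
  suc (length us + length vs) ≡⟨ ℕ.+-suc (length us) (length vs) ⟨
  length us + length (x ∷ vs) ≡⟨ L.length-++ us ⟨
  length (us L.++ x ∷ vs)     ∎
  where
  open ℕ.≤-Reasoning
  xs⊆us++vs : xs ⊆ us L.++ vs
  xs⊆us++vs {z} z∈xs with ∈-++⁻ us (xs⊆ys (there z∈xs))
  ... | inj₁ z∈us = ∈-++⁺ˡ z∈us
  ... | inj₂ (here refl) = ⊥-elim (All.lookup x∉xs z∈xs refl)
  ... | inj₂ (there z∈vs) = ∈-++⁺ʳ us z∈vs

Unique-map⁺ : ∀ {a b} {A : Set a} {B : Set b} (f : A → B) {xs : List A} →
  (∀ {x y} → x ∈ xs → y ∈ xs → f x ≡ f y → x ≡ y) → Unique xs → Unique (L.map f xs)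
Unique-map⁺ f {[]} _ [] = []
Unique-map⁺ f {x ∷ xs} injective (x∉xs ∷ unique) =
  All.map⁺ (All.tabulate λ y∈xs fx≡fy → All.lookup x∉xs y∈xs (injective (here refl) (there y∈xs) fx≡fy)) ∷
  Unique-map⁺ f (λ x∈ y∈ → injective (there x∈) (there y∈)) unique

length-≤-by-injection : ∀ {a b} {A : Set a} {B : Set b} (f : A → B) {xs : List A} {ys : List B} →
  Unique xs → (∀ {x y} → x ∈ xs → y ∈ xs → f x ≡ f y → x ≡ y) → (∀ {x} → x ∈ xs → f x ∈ ys) →
  length xs ≤ length ys
length-≤-by-injection f {xs} {ys} unique injective maps-into = begin
  length xs           ≡⟨ L.length-map f xs ⟨
  length (L.map f xs) ≤⟨ length-≤-of-Unique-⊆ (Unique-map⁺ f injective unique) image⊆ys ⟩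
  length ys           ∎
  where
  open ℕ.≤-Reasoning
  image⊆ys : L.map f xs ⊆ ys
  image⊆ys fx∈ with ∈-map⁻ f fx∈
  ... | x , x∈xs , refl = maps-into x∈xs

concatMap-map≡cartesianProductWith : ∀ {a b c} {A : Set a} {B : Set b} {C : Set c}
  (f : A → B → C) xs ys → L.concatMap (λ x → L.map (f x) ys) xs ≡ cartesianProductWith f xs ys
concatMap-map≡cartesianProductWith f [] ys = refl
concatMap-map≡cartesianProductWith f (x ∷ xs) ys =
  cong (L.map (f x) ys L.++_) (concatMap-map≡cartesianProductWith f xs ys)

module _ {a} {A : Set a} where

  allVecs-suc : ∀ (xs : List A) k →
                allVecs xs (suc k) ≡ cartesianProductWith V._∷_ xs (allVecs xs k)
  allVecs-suc xs k = concatMap-map≡cartesianProductWith V._∷_ xs (allVecs xs k)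

  ∈-allVecs : ∀ {xs : List A} → (∀ x → x ∈ xs) → ∀ {k} (v : Vec A k) → v ∈ allVecs xs k
  ∈-allVecs all∈ V.[] = here refl
  ∈-allVecs {xs} all∈ (x V.∷ v) = subst (_ ∈_) (sym (allVecs-suc xs _))
    (∈-cartesianProductWith⁺ V._∷_ (all∈ x) (∈-allVecs all∈ v))

  allVecs-unique : ∀ {xs : List A} → Unique xs → ∀ k → Unique (allVecs xs k)
  allVecs-unique unique zero = [] ∷ []
  allVecs-unique {xs} unique (suc k) = subst Unique (sym (allVecs-suc xs k))
    (Unique.cartesianProductWith⁺ V._∷_ V.∷-injective unique (allVecs-unique unique k))

lookup-extensionality : ∀ {a} {A : Set a} {k} {v w : Vec A k} →
                        (∀ i → lookup v i ≡ lookup w i) → v ≡ w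
lookup-extensionality {v = v} {w} v≗w =
  trans (sym (V.tabulate∘lookup v)) (trans (V.tabulate-cong v≗w) (V.tabulate∘lookup w))

PairSet-extensionality : ∀ {n} {S S′ : PairSet n} →
  (∀ j i → S ∋ j , i → S′ ∋ j , i) → (∀ j i → S′ ∋ j , i → S ∋ j , i) → S ≡ S′
PairSet-extensionality S⊆S′ S′⊆S =
  lookup-extensionality λ j → lookup-extensionality λ i → same-bit (S⊆S′ j i) (S′⊆S j i)
  where
  same-bit : ∀ {b b′ : Bool} → (b ≡ true → b′ ≡ true) → (b′ ≡ true → b ≡ true) → b ≡ b′
  same-bit {true} b⇒b′ _ = sym (b⇒b′ refl)
  same-bit {false} {true} _ b′⇒b = b′⇒b refl
  same-bit {false} {false} _ _ = refl

preference : ∀ {n} → PairSet n → Fin n → Fin n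
preference S i = fromMaybe i (sourceOf S i)

lookup-of-≡tabulate : ∀ {a} {A : Set a} {k} (v : Vec A k) {f : Fin k → A} → v ≡ tabulate f →
                      ∀ i → lookup v i ≡ f i
lookup-of-≡tabulate _ refl = V.lookup∘tabulate _

-- The case split of Ψ is a local helper of its definition, so entries of Ψ are read through
-- `preference`.
lookup-Ψ : ∀ {n} (π : Permutation′ n) S c → lookup (Ψ π S) c ≡ preference S (π ⟨$⟩ˡ c)
lookup-Ψ π S c with sourceOf S (π ⟨$⟩ˡ c) | lookup-of-≡tabulate (Ψ π S) refl c
... | nothing | eq = eq
... | just _  | eq = eq

preference-view : ∀ {n} (S : PairSet n) i →
  (∃ λ j → S ∋ j , i × preference S i ≡ j) ⊎ ((∀ j → ¬ S ∋ j , i) × preference S i ≡ i)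
preference-view S i with sourceOf S i in eq
... | just j  = inj₁ (j , proj₁ (head-filter-allFin≡just⇒least (λ j → S ∋? j , i) eq) , refl)
... | nothing = inj₂ (head-filter-allFin≡nothing⇒∄ (λ j → S ∋? j , i) eq , refl)

preference≡⇒∋ : ∀ {n} (S : PairSet n) {j i} → preference S i ≡ j → j F.< i → S ∋ j , i
preference≡⇒∋ S {i = i} pref≡j j<i with preference-view S i
... | inj₁ (j′ , j′i∈S , pref≡j′) = subst (λ j → S ∋ j , i) (trans (sym pref≡j′) pref≡j) j′i∈S
... | inj₂ (_ , pref≡i) = ⊥-elim (ℕ.<-irrefl (cong toℕ (trans (sym pref≡j) pref≡i)) j<i)

module _ {n} (π : Permutation′ n) (S : PairSet n) (sub : InSub π S) where

  preference-of-edge : ∀ {j i} → S ∋ j , i → preference S i ≡ j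
  preference-of-edge {j} {i} ji∈S with preference-view S i
  ... | inj₁ (j′ , j′i∈S , pref≡j′) = trans pref≡j′ (proj₂ sub i j′ j j′i∈S ji∈S)
  ... | inj₂ (no-edge , _) = ⊥-elim (no-edge j ji∈S)

  edges-determined-by-preference : ∀ (S′ : PairSet n) → (∀ i → preference S i ≡ preference S′ i) →
                                   ∀ j i → S ∋ j , i → S′ ∋ j , i
  edges-determined-by-preference S′ same j i ji∈S =
    preference≡⇒∋ S′ (trans (sym (same i)) (preference-of-edge ji∈S)) (proj₁ (proj₁ sub j i ji∈S))

Ψ-injective-on-Sub : ∀ {n} (π : Permutation′ n) {S S′ : PairSet n} →
                     InSub π S → InSub π S′ → Ψ π S ≡ Ψ π S′ → S ≡ S′
Ψ-injective-on-Sub π {S} {S′} sub sub′ Ψ≡ = PairSet-extensionality {S = S} {S′}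
  (edges-determined-by-preference π S sub S′ same-preference)
  (edges-determined-by-preference π S′ sub′ S (λ i → sym (same-preference i)))
  where
  preference-via-Ψ : ∀ T i → preference T i ≡ lookup (Ψ π T) (π ⟨$⟩ʳ i)
  preference-via-Ψ T i = trans (cong (preference T) (sym (inverseˡ π))) (sym (lookup-Ψ π T _))
  same-preference : ∀ i → preference S i ≡ preference S′ i
  same-preference i = trans (preference-via-Ψ S i)
    (trans (cong (λ v → lookup v (π ⟨$⟩ʳ i)) Ψ≡) (sym (preference-via-Ψ S′ i)))

step-into-free : ∀ {n} (st : Street n) c a → lookup st a ≡ nothing →
                 step st c a ≡ just (st [ a ]≔ just c)
step-into-free st c a a-free with lookup st a
... | nothing = refl

step-bumping : ∀ {n} (st : Street n) c a {b k} → lookup st a ≡ just b → firstFreeAfter st a ≡ just k →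
               step st c a ≡ just ((st [ a ]≔ just c) [ k ]≔ just b)
step-bumping st c a a-holds-b k-first with lookup st a
... | just _ with firstFreeAfter st a
step-bumping st c a refl refl | just _ | just _ = refl

module _ {n} (S : PairSet n) (sep : HorizSep S) where

  covering-edge-unique : ∀ {j i j′ i′} {s : Fin n} → S ∋ j , i → S ∋ j′ , i′ →
    j F.≤ s → s F.≤ i → j′ F.≤ s → s F.≤ i′ → j ≡ j′ × i ≡ i′
  covering-edge-unique {j} {i} {j′} {i′} ji∈S j′i′∈S j≤s s≤i j′≤s s≤i′ =
    same-edge (j F.≟ j′) (i F.≟ i′)
    where
    separated⇒⊥ : i F.< j′ ⊎ i′ F.< j → ⊥
    separated⇒⊥ (inj₁ i<j′) = ℕ.<⇒≱ i<j′ (ℕ.≤-trans j′≤s s≤i)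
    separated⇒⊥ (inj₂ i′<j) = ℕ.<⇒≱ i′<j (ℕ.≤-trans j≤s s≤i′)
    same-edge : Dec (j ≡ j′) → Dec (i ≡ i′) → j ≡ j′ × i ≡ i′
    same-edge (yes j≡j′) (yes i≡i′) = j≡j′ , i≡i′
    same-edge (no j≢j′)  _          = ⊥-elim (separated⇒⊥ (sep j i j′ i′ ji∈S j′i′∈S (inj₁ j≢j′)))
    same-edge (yes _)    (no i≢i′)  = ⊥-elim (separated⇒⊥ (sep j i j′ i′ ji∈S j′i′∈S (inj₂ i≢i′)))

module HorizontallySeparated {n} (π : Permutation′ n) (S : PairSet n)
                             (sub : InSub π S) (sep : HorizSep S) where

  car : Fin n → Fin n
  car s = π ⟨$⟩ʳ s

  entry : Fin n → ℕ
  entry s = toℕ (car s)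

  entry-injective : ∀ {s s′} → entry s ≡ entry s′ → s ≡ s′
  entry-injective = Injection.injective (↔⇒↣ π) ∘ FP.toℕ-injective

  -- Cars enter in the order 0, 1, …, so the car `car s` of spot s enters at time `entry s`.
  -- `Invariant t` describes the street after t cars have entered.  A spot outside every interval
  -- [j , i] of an edge whose car `car i` has entered holds its own car if that has entered and is
  -- empty otherwise.  Inside such an interval `car i` waits at the first spot whose own car has
  -- not entered (at i if there is none), and the other spots are as outside.
  Covers : ℕ → Fin n → Fin n → Fin n → Set
  Covers t j i s = S ∋ j , i × entry i < t × j F.≤ s × s F.≤ i

  EnteredFrom : ℕ → Fin n → Fin n → Set
  EnteredFrom t j s = ∀ s′ → j F.≤ s′ → s′ F.< s → entry s′ < t

  CoveredSpot : ℕ → Fin n → Fin n → Fin n → Maybe (Fin n) → Set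
  CoveredSpot t j i s v =
    (s ≢ i × entry s < t × v ≡ just (car s)) ⊎
    ((s ≡ i ⊎ t ≤ entry s) × EnteredFrom t j s × v ≡ just (car i)) ⊎
    ((s ≡ i ⊎ t ≤ entry s) × ¬ EnteredFrom t j s × v ≡ nothing)

  UncoveredSpot : ℕ → Fin n → Maybe (Fin n) → Set
  UncoveredSpot t s v = (entry s < t × v ≡ just (car s)) ⊎ (t ≤ entry s × v ≡ nothing)

  SpotSpec : ℕ → Fin n → Maybe (Fin n) → Set
  SpotSpec t s v = (∃₂ λ j i → Covers t j i s × CoveredSpot t j i s v) ⊎
                   ((∀ j i → ¬ Covers t j i s) × UncoveredSpot t s v)

  Invariant : ℕ → Street n → Set
  Invariant t st = ∀ s → SpotSpec t s (lookup st s)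

  unique-cover : ∀ {j i j′ i′} {s : Fin n} → S ∋ j , i → S ∋ j′ , i′ →
    j F.≤ s → s F.≤ i → j′ F.≤ s → s F.≤ i′ → j ≡ j′ × i ≡ i′
  unique-cover = covering-edge-unique S sep

  SpotSpec-covered : ∀ {t s v j i} → SpotSpec t s v → Covers t j i s → CoveredSpot t j i s v
  SpotSpec-covered (inj₁ (j′ , i′ , (j′i′∈S , _ , j′≤s , s≤i′) , covered)) (ji∈S , _ , j≤s , s≤i)
    with unique-cover ji∈S j′i′∈S j≤s s≤i j′≤s s≤i′
  ... | refl , refl = covered
  SpotSpec-covered {j = j} {i} (inj₂ (uncovered , _)) cover = ⊥-elim (uncovered j i cover)

  Covers-suc : ∀ {t j i s} → Covers t j i s → Covers (suc t) j i s
  Covers-suc (ji∈S , i-entered , j≤s , s≤i) = ji∈S , ℕ.m<n⇒m<1+n i-entered , j≤s , s≤i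

  SpotSpec-suc : ∀ {t s v} → SpotSpec t s v → entry s ≢ t →
    (∀ j i → Covers (suc t) j i s → Covers t j i s) →
    (∀ j i → Covers t j i s → EnteredFrom (suc t) j s → EnteredFrom t j s) →
    SpotSpec (suc t) s v
  SpotSpec-suc {t} {s} (inj₁ (j , i , cover , covered)) s≢new _ entered-pred =
    inj₁ (j , i , Covers-suc cover , covered-suc covered)
    where
    waiting-suc : (s ≡ i) ⊎ t ≤ entry s → (s ≡ i) ⊎ suc t ≤ entry s
    waiting-suc (inj₁ s≡i) = inj₁ s≡i
    waiting-suc (inj₂ t≤s) = inj₂ (ℕ.≤∧≢⇒< t≤s (≢-sym s≢new))
    covered-suc : ∀ {v} → CoveredSpot t j i s v → CoveredSpot (suc t) j i s v
    covered-suc (inj₁ (s≢i , entered , v≡)) = inj₁ (s≢i , ℕ.m<n⇒m<1+n entered , v≡)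
    covered-suc (inj₂ (inj₁ (waiting , all-entered , v≡))) =
      inj₂ (inj₁ (waiting-suc waiting , (λ s′ j≤s′ s′<s → ℕ.m<n⇒m<1+n (all-entered s′ j≤s′ s′<s)) , v≡))
    covered-suc (inj₂ (inj₂ (waiting , ¬all-entered , v≡))) =
      inj₂ (inj₂ (waiting-suc waiting , ¬all-entered ∘ entered-pred j i cover , v≡))
  SpotSpec-suc {t} {s} (inj₂ (uncovered , spot)) s≢new covers-pred _ =
    inj₂ ((λ j i → uncovered j i ∘ covers-pred j i) , uncovered-suc spot)
    where
    uncovered-suc : ∀ {v} → UncoveredSpot t s v → UncoveredSpot (suc t) s v
    uncovered-suc (inj₁ (entered , v≡)) = inj₁ (ℕ.m<n⇒m<1+n entered , v≡)
    uncovered-suc (inj₂ (t≤s , v≡))    = inj₂ (ℕ.≤∧≢⇒< t≤s (≢-sym s≢new) , v≡)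

  EnteredFrom-pred : ∀ {t j s} q → entry q ≡ t → ¬ (j F.≤ q × q F.< s) →
                     EnteredFrom (suc t) j s → EnteredFrom t j s
  EnteredFrom-pred {t} q q-new q-outside all-entered s′ j≤s′ s′<s with entry s′ ℕ.≟ t
  ... | no s′≢new = ℕ.≤∧≢⇒< (ℕ.m<1+n⇒m≤n (all-entered s′ j≤s′ s′<s)) s′≢new
  ... | yes s′-new with entry-injective {s′} {q} (trans s′-new (sym q-new))
  ...   | refl = ⊥-elim (q-outside (j≤s′ , s′<s))

  preferences : Vec (Fin n) n
  preferences = Ψ π S

  StepPreserves : Fin n → Street n → Set
  StepPreserves c st =
    ∃ λ st′ → step st c (lookup preferences c) ≡ just st′ × Invariant (suc (toℕ c)) st′

  module Entering (c : Fin n) where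

    home : Fin n
    home = π ⟨$⟩ˡ c

    t : ℕ
    t = toℕ c

    home-new : entry home ≡ t
    home-new = cong toℕ (inverseʳ π)

    home-entered : entry home < suc t
    home-entered = s≤s (ℕ.≤-reflexive home-new)

    ¬home-entered-before : ¬ entry home < t
    ¬home-entered-before = ℕ.<-irrefl home-new

    c≡car-home : just c ≡ just (car home)
    c≡car-home = cong just (sym (inverseʳ π))

    only-home-new : ∀ {s} → s ≢ home → entry s ≢ t
    only-home-new s≢home s-new = s≢home (entry-injective (trans s-new (sym home-new)))

  module PrefersSource (c : Fin n) (st : Street n) (inv : Invariant (toℕ c) st)
                      (j : Fin n) (edge : S ∋ j , Entering.home c) where
    open Entering c

    j<home : j F.< home
    j<home = proj₁ (proj₁ sub j home edge)

    t<entry-j : t < entry j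
    t<entry-j = subst (_< entry j) home-new (proj₂ (proj₁ sub j home edge))

    j-free : lookup st j ≡ nothing
    j-free with inv j
    ... | inj₁ (j′ , i′ , (j′i′∈S , i′-entered , j′≤j , j≤i′) , _)
      with unique-cover edge j′i′∈S ℕ.≤-refl (ℕ.<⇒≤ j<home) j′≤j j≤i′
    ...   | refl , refl = ⊥-elim (¬home-entered-before i′-entered)
    j-free | inj₂ (_ , inj₁ (j-entered , _)) = ⊥-elim (ℕ.<⇒≱ j-entered (ℕ.<⇒≤ t<entry-j))
    j-free | inj₂ (_ , inj₂ (_ , j-empty)) = j-empty

    ¬EnteredFrom-j : ∀ s → j F.< s → ¬ EnteredFrom (suc t) j s
    ¬EnteredFrom-j s j<s all-entered = ℕ.<⇒≱ (all-entered j ℕ.≤-refl j<s) t<entry-j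

    st′ : Street n
    st′ = st [ j ]≔ just c

    inside-step : ∀ s → s ≢ j → j F.≤ s → s F.≤ home → ∀ {v} → SpotSpec t s v → SpotSpec (suc t) s v
    inside-step s s≢j j≤s s≤home (inj₁ (j′ , i′ , (j′i′∈S , i′-entered , j′≤s , s≤i′) , _))
      with unique-cover edge j′i′∈S j≤s s≤home j′≤s s≤i′
    ... | refl , refl = ⊥-elim (¬home-entered-before i′-entered)
    inside-step s s≢j j≤s s≤home (inj₂ _) with s F.≟ home
    inside-step s s≢j j≤s s≤home (inj₂ (_ , inj₁ (s-entered , _))) | yes refl =
      ⊥-elim (¬home-entered-before s-entered)
    inside-step s s≢j j≤s s≤home (inj₂ (_ , inj₂ (_ , s-empty))) | yes refl =
      inj₁ (j , home , (edge , home-entered , j≤s , s≤home) ,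
            inj₂ (inj₂ (inj₁ refl , ¬EnteredFrom-j home j<home , s-empty)))
    inside-step s s≢j j≤s s≤home (inj₂ (_ , inj₁ (s-entered , s-holds))) | no s≢home =
      inj₁ (j , home , (edge , home-entered , j≤s , s≤home) ,
            inj₁ (s≢home , ℕ.m<n⇒m<1+n s-entered , s-holds))
    inside-step s s≢j j≤s s≤home (inj₂ (_ , inj₂ (t≤s , s-empty))) | no s≢home =
      inj₁ (j , home , (edge , home-entered , j≤s , s≤home) ,
            inj₂ (inj₂ (inj₂ (ℕ.≤∧≢⇒< t≤s (≢-sym (only-home-new s≢home))) ,
                        ¬EnteredFrom-j s (FP.≤∧≢⇒< j≤s (≢-sym s≢j)) , s-empty)))

    outside-step : ∀ s → ¬ (j F.≤ s × s F.≤ home) → ∀ {v} → SpotSpec t s v → SpotSpec (suc t) s v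
    outside-step s s-outside spec =
      SpotSpec-suc spec (only-home-new s≢home) covers-pred entered-pred
      where
      s≢home : s ≢ home
      s≢home refl = s-outside (ℕ.<⇒≤ j<home , ℕ.≤-refl)
      covers-pred : ∀ j′ i′ → Covers (suc t) j′ i′ s → Covers t j′ i′ s
      covers-pred j′ i′ (j′i′∈S , i′-entered , j′≤s , s≤i′) with entry i′ ℕ.≟ t
      ... | no i′-old = j′i′∈S , ℕ.≤∧≢⇒< (ℕ.m<1+n⇒m≤n i′-entered) i′-old , j′≤s , s≤i′
      ... | yes i′-new with entry-injective {i′} {home} (trans i′-new (sym home-new))
      ...   | refl with proj₂ sub home j′ j j′i′∈S edge
      ...     | refl = ⊥-elim (s-outside (j′≤s , s≤i′))
      entered-pred : ∀ j′ i′ → Covers t j′ i′ s → EnteredFrom (suc t) j′ s → EnteredFrom t j′ s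
      entered-pred j′ i′ (j′i′∈S , i′-entered , j′≤s , s≤i′) =
        EnteredFrom-pred home home-new home-outside
        where
        home-outside : ¬ (j′ F.≤ home × home F.< s)
        home-outside (j′≤home , home<s)
          with unique-cover edge j′i′∈S (ℕ.<⇒≤ j<home) ℕ.≤-refl j′≤home
                            (ℕ.≤-trans (ℕ.<⇒≤ home<s) s≤i′)
        ... | refl , refl = ¬home-entered-before i′-entered

    inv′ : Invariant (suc t) st′
    inv′ s with s F.≟ j
    ... | yes refl rewrite V.lookup∘update j st (just c) =
      inj₁ (j , home , (edge , home-entered , ℕ.≤-refl , ℕ.<⇒≤ j<home) ,
            inj₂ (inj₁ (inj₂ t<entry-j , (λ _ j≤s′ s′<j → ⊥-elim (ℕ.<⇒≱ s′<j j≤s′)) , c≡car-home)))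
    ... | no s≢j rewrite V.lookup∘update′ s≢j st (just c) with (j F.≤? s) ×-dec (s F.≤? home)
    ...   | yes (j≤s , s≤home) = inside-step s s≢j j≤s s≤home (inv s)
    ...   | no s-outside = outside-step s s-outside (inv s)

    result : lookup preferences c ≡ j → StepPreserves c st
    result pref≡j = st′ , trans (cong (step st c) pref≡j) (step-into-free st c j j-free) , inv′

  module PrefersHome (c : Fin n) (st : Street n) (inv : Invariant (toℕ c) st)
                    (no-edge : ∀ j → ¬ (S ∋ j , Entering.home c)) where
    open Entering c

    st′ : Street n
    st′ = st [ home ]≔ just c

    covers-pred : ∀ s j i → Covers (suc t) j i s → Covers t j i s
    covers-pred s j i (ji∈S , i-entered , j≤s , s≤i) with entry i ℕ.≟ t
    ... | no i-old = ji∈S , ℕ.≤∧≢⇒< (ℕ.m<1+n⇒m≤n i-entered) i-old , j≤s , s≤i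
    ... | yes i-new with entry-injective {i} {home} (trans i-new (sym home-new))
    ...   | refl = ⊥-elim (no-edge j ji∈S)

    module Uncovered (uncovered : ∀ j i → ¬ Covers t j i home)
                     (home-free : lookup st home ≡ nothing) where

      inv′ : Invariant (suc t) st′
      inv′ s with s F.≟ home
      ... | yes refl rewrite V.lookup∘update home st (just c) =
        inj₂ ((λ j i → uncovered j i ∘ covers-pred home j i) , inj₁ (home-entered , c≡car-home))
      ... | no s≢home rewrite V.lookup∘update′ s≢home st (just c) =
        SpotSpec-suc (inv s) (only-home-new s≢home) (covers-pred s) entered-pred
        where
        entered-pred : ∀ j i → Covers t j i s → EnteredFrom (suc t) j s → EnteredFrom t j s
        entered-pred j i (ji∈S , i-entered , _ , s≤i) = EnteredFrom-pred home home-new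
          λ (j≤home , home<s) →
            uncovered j i (ji∈S , i-entered , j≤home , ℕ.≤-trans (ℕ.<⇒≤ home<s) s≤i)

    module Covered (j i : Fin n) (edge : S ∋ j , i) (i-entered : entry i < t)
                   (j≤home : j F.≤ home) (home≤i : home F.≤ i) where

      home≢i : home ≢ i
      home≢i home≡i = no-edge j (subst (λ x → S ∋ j , x) (sym home≡i) edge)

      home<i : home F.< i
      home<i = FP.≤∧≢⇒< home≤i home≢i

      cover : Covers t j i home
      cover = edge , i-entered , j≤home , home≤i

      untouched-step : ∀ s → s ≢ home → (home F.< s → s F.≤ i → ¬ EnteredFrom (suc t) j s) →
                       ∀ {v} → SpotSpec t s v → SpotSpec (suc t) s v
      untouched-step s s≢home ¬entered-s spec =
        SpotSpec-suc spec (only-home-new s≢home) (covers-pred s) entered-pred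
        where
        entered-pred : ∀ j′ i′ → Covers t j′ i′ s → EnteredFrom (suc t) j′ s → EnteredFrom t j′ s
        entered-pred j′ i′ (j′i′∈S , _ , _ , s≤i′) entered with (j′ F.≤? home) ×-dec (home F.<? s)
        ... | no home-outside = EnteredFrom-pred home home-new home-outside entered
        ... | yes (j′≤home , home<s)
          with unique-cover edge j′i′∈S j≤home home≤i j′≤home (ℕ.≤-trans (ℕ.<⇒≤ home<s) s≤i′)
        ...   | refl , refl = ⊥-elim (¬entered-s home<s s≤i′ entered)

      module Park (¬entered : ¬ EnteredFrom t j home) (home-free : lookup st home ≡ nothing) where

        inv′ : Invariant (suc t) st′
        inv′ s with s F.≟ home
        ... | yes refl rewrite V.lookup∘update home st (just c) =
          inj₁ (j , i , Covers-suc cover , inj₁ (home≢i , home-entered , c≡car-home))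
        ... | no s≢home rewrite V.lookup∘update′ s≢home st (just c) =
          untouched-step s s≢home (λ home<s _ entered → ¬entered λ s′ j≤s′ s′<home →
              ℕ.≤∧≢⇒< (ℕ.m<1+n⇒m≤n (entered s′ j≤s′ (FP.<-trans s′<home home<s)))
                      (only-home-new (FP.<⇒≢ s′<home)))
            (inv s)

      module Bump (entered : EnteredFrom t j home) (home-holds : lookup st home ≡ just (car i)) where

        i-free : lookup st i ≡ nothing
        i-free with SpotSpec-covered (inv i) (edge , i-entered , ℕ.≤-trans j≤home home≤i , ℕ.≤-refl)
        ... | inj₁ (i≢i , _ , _) = ⊥-elim (i≢i refl)
        ... | inj₂ (inj₁ (_ , entered-i , _)) =
          ⊥-elim (¬home-entered-before (entered-i home j≤home home<i))
        ... | inj₂ (inj₂ (_ , _ , i-empty)) = i-empty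

        module Landing (k : Fin n) (home<k : home F.< k) (k-free : lookup st k ≡ nothing)
                       (k-first : ∀ k′ → k′ F.< k → ¬ (home F.< k′ × lookup st k′ ≡ nothing)) where

          k≤i : k F.≤ i
          k≤i = ℕ.≮⇒≥ λ i<k → k-first i i<k (home<i , i-free)

          k≢home : k ≢ home
          k≢home k≡home = FP.<-irrefl (sym k≡home) home<k

          cover-k : Covers t j i k
          cover-k = edge , i-entered , ℕ.≤-trans j≤home (ℕ.<⇒≤ home<k) , k≤i

          k-waiting : (k ≡ i) ⊎ suc t ≤ entry k
          k-waiting with SpotSpec-covered (inv k) cover-k
          ... | inj₁ (_ , _ , k-holds) with trans (sym k-holds) k-free
          ...   | ()
          k-waiting | inj₂ (inj₁ (_ , _ , k-holds)) with trans (sym k-holds) k-free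
          ...   | ()
          k-waiting | inj₂ (inj₂ (inj₁ k≡i , _)) = inj₁ k≡i
          k-waiting | inj₂ (inj₂ (inj₂ t≤k , _)) = inj₂ (ℕ.≤∧≢⇒< t≤k (≢-sym (only-home-new k≢home)))

          between : ∀ s → home F.< s → s F.< k → entry s < t × lookup st s ≡ just (car s)
          between s home<s s<k
            with SpotSpec-covered (inv s) (edge , i-entered , ℕ.≤-trans j≤home (ℕ.<⇒≤ home<s) ,
                                                             ℕ.≤-trans (ℕ.<⇒≤ s<k) k≤i)
          ... | inj₁ (_ , s-entered , s-holds) = s-entered , s-holds
          ... | inj₂ (inj₁ (_ , entered-s , _)) =
            ⊥-elim (¬home-entered-before (entered-s home j≤home home<s))
          ... | inj₂ (inj₂ (_ , _ , s-empty)) = ⊥-elim (k-first s s<k (home<s , s-empty))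

          entered-k : EnteredFrom (suc t) j k
          entered-k s j≤s s<k with FP.<-cmp s home
          ... | tri< s<home _ _ = ℕ.m<n⇒m<1+n (entered s j≤s s<home)
          ... | tri≈ _ refl _   = home-entered
          ... | tri> _ _ home<s = ℕ.m<n⇒m<1+n (proj₁ (between s home<s s<k))

          st″ : Street n
          st″ = st′ [ k ]≔ just (car i)

          inv″ : Invariant (suc t) st″
          inv″ s with s F.≟ k
          ... | yes refl rewrite V.lookup∘update k st′ (just (car i)) =
            inj₁ (j , i , Covers-suc cover-k , inj₂ (inj₁ (k-waiting , entered-k , refl)))
          ... | no s≢k rewrite V.lookup∘update′ s≢k st′ (just (car i)) with s F.≟ home
          ...   | yes refl rewrite V.lookup∘update home st (just c) =
            inj₁ (j , i , Covers-suc cover , inj₁ (home≢i , home-entered , c≡car-home))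
          ...   | no s≢home rewrite V.lookup∘update′ s≢home st (just c)
                  with (home F.<? s) ×-dec (s F.<? k)
          ...     | yes (home<s , s<k) =
            inj₁ (j , i , (edge , ℕ.m<n⇒m<1+n i-entered , ℕ.≤-trans j≤home (ℕ.<⇒≤ home<s) ,
                           ℕ.≤-trans (ℕ.<⇒≤ s<k) k≤i) ,
                  inj₁ (FP.<⇒≢ (ℕ.<-≤-trans s<k k≤i) , ℕ.m<n⇒m<1+n (proj₁ (between s home<s s<k)) ,
                        proj₂ (between s home<s s<k)))
          ...     | no s-outside = untouched-step s s≢home k-not-waiting (inv s)
            where
            k-not-waiting : home F.< s → s F.≤ i → ¬ EnteredFrom (suc t) j s
            k-not-waiting home<s s≤i entered = k-still-waiting k-waiting
              where
              k<s : k F.< s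
              k<s = FP.≤∧≢⇒< (ℕ.≮⇒≥ λ s<k → s-outside (home<s , s<k)) (≢-sym s≢k)
              k-still-waiting : ¬ ((k ≡ i) ⊎ suc t ≤ entry k)
              k-still-waiting (inj₁ refl) = ℕ.<⇒≱ k<s s≤i
              k-still-waiting (inj₂ t<k) =
                ℕ.<⇒≱ (entered k (ℕ.≤-trans j≤home (ℕ.<⇒≤ home<k)) k<s) t<k

        result : lookup preferences c ≡ home → StepPreserves c st
        result pref≡home with firstFreeAfter st home in first-free
        ... | nothing = ⊥-elim (head-filter-allFin≡nothing⇒∄ _ first-free i (home<i , i-free))
        ... | just k with head-filter-allFin≡just⇒least _ first-free
        ...   | (home<k , k-free) , k-first =
          st″ , trans (cong (step st c) pref≡home) (step-bumping st c home home-holds first-free) ,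
          inv″
          where open Landing k home<k k-free k-first

    park : lookup preferences c ≡ home → lookup st home ≡ nothing → Invariant (suc t) st′ →
           StepPreserves c st
    park pref≡home home-free inv′ =
      st′ , trans (cong (step st c) pref≡home) (step-into-free st c home home-free) , inv′

    result : lookup preferences c ≡ home → StepPreserves c st
    result pref≡home with inv home
    ... | inj₂ (_ , inj₁ (entered-before , _)) = ⊥-elim (¬home-entered-before entered-before)
    ... | inj₂ (uncovered , inj₂ (_ , home-free)) =
      park pref≡home home-free (Uncovered.inv′ uncovered home-free)
    ... | inj₁ (j , i , (edge , i-entered , j≤home , home≤i) , spot) with spot
    ...   | inj₁ (_ , entered-before , _) = ⊥-elim (¬home-entered-before entered-before)
    ...   | inj₂ (inj₂ (_ , ¬entered , home-free)) =
      park pref≡home home-free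
        (Covered.Park.inv′ j i edge i-entered j≤home home≤i ¬entered home-free)
    ...   | inj₂ (inj₁ (_ , entered , home-holds)) =
      Covered.Bump.result j i edge i-entered j≤home home≤i entered home-holds pref≡home

  step-preserves-Invariant : ∀ c st → Invariant (toℕ c) st → StepPreserves c st
  step-preserves-Invariant c st inv with preference-view S (Entering.home c)
  ... | inj₁ (j , edge , pref≡j) =
    PrefersSource.result c st inv j edge (trans (lookup-Ψ π S c) pref≡j)
  ... | inj₂ (no-edge , pref≡home) =
    PrefersHome.result c st inv no-edge (trans (lookup-Ψ π S c) pref≡home)

  -- `runMVP preferences` is by definition `L.foldl enter (just emptyStreet) (allFin n)`.
  enter : Maybe (Street n) → Fin n → Maybe (Street n)
  enter ms c = ms >>= λ st → step st c (lookup preferences c)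

  run-preserves-Invariant : ∀ {m} (cars : Fin m → Fin n) d → (∀ k → toℕ (cars k) ≡ d + toℕ k) →
    ∀ st → Invariant d st →
    ∃ λ st′ → L.foldl enter (just st) (L.tabulate cars) ≡ just st′ × Invariant (d + m) st′
  run-preserves-Invariant {zero} cars d _ st inv =
    st , refl , subst (λ t → Invariant t st) (sym (ℕ.+-identityʳ d)) inv
  run-preserves-Invariant {suc m} cars d consecutive st inv =
    continue (step-preserves-Invariant (cars F.zero) st
               (subst (λ t → Invariant t st) (sym first-is-d) inv))
    where
    first-is-d : toℕ (cars F.zero) ≡ d
    first-is-d = trans (consecutive F.zero) (ℕ.+-identityʳ d)
    continue : StepPreserves (cars F.zero) st →
      ∃ λ st′ → L.foldl enter (just st) (L.tabulate cars) ≡ just st′ × Invariant (d + suc m) st′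
    continue (st₁ , stepped , inv₁) rewrite stepped =
      let st₂ , ran , inv₂ = run-preserves-Invariant (cars ∘ F.suc) (suc d)
                               (λ k → trans (consecutive (F.suc k)) (ℕ.+-suc d (toℕ k))) st₁
                               (subst (λ t → Invariant (suc t) st₁) first-is-d inv₁)
      in st₂ , ran , subst (λ t → Invariant t st₂) (sym (ℕ.+-suc d m)) inv₂

  Invariant-empty : Invariant 0 emptyStreet
  Invariant-empty s rewrite V.lookup∘tabulate (λ (_ : Fin n) → nothing {A = Fin n}) s =
    inj₂ ((λ _ _ (_ , entered , _) → ℕ.n≮0 entered) , inj₂ (z≤n , refl))

  Invariant-end : ∀ st → Invariant n st → ∀ s → lookup st s ≡ just (car s)
  Invariant-end st inv s with inv s
  ... | inj₁ (_ , _ , _ , inj₁ (_ , _ , s-holds)) = s-holds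
  ... | inj₁ (_ , _ , _ , inj₂ (inj₁ (inj₁ refl , _ , s-holds))) = s-holds
  ... | inj₁ (_ , _ , _ , inj₂ (inj₁ (inj₂ n≤s , _))) = ⊥-elim (ℕ.<⇒≱ (FP.toℕ<n (car s)) n≤s)
  ... | inj₁ (_ , _ , _ , inj₂ (inj₂ (_ , ¬entered , _))) =
    ⊥-elim (¬entered λ s′ _ _ → FP.toℕ<n (car s′))
  ... | inj₂ (_ , inj₁ (_ , s-holds)) = s-holds
  ... | inj₂ (_ , inj₂ (n≤s , _)) = ⊥-elim (ℕ.<⇒≱ (FP.toℕ<n (car s)) n≤s)

  Ψ-valid : Valid π S
  Ψ-valid with run-preserves-Invariant (λ c → c) 0 (λ _ → refl) emptyStreet Invariant-empty
  ... | st , ran , inv =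
    trans ran (cong just (trans (sym (V.tabulate∘lookup st)) (V.tabulate-cong (Invariant-end st inv))))

horizontally-separated⇒valid : ∀ {n} (π : Permutation′ n) (S : PairSet n) →
                               InSub π S → HorizSep S → Valid π S
horizontally-separated⇒valid = HorizontallySeparated.Ψ-valid

separated-count≤outcome-count : ∀ {n} (π : Permutation′ n) →
  ((S : PairSet n) → InSub π S → HorizSep S → Valid π S) →
  length (filter (λ S → inSub? π S ×-dec horizSep? S) (allPairSets n))
    ≤ length (filter (λ p → hasOutcome? p π) (allPreferences n))
separated-count≤outcome-count {n} π valid =
  length-≤-by-injection (Ψ π) separated-unique Ψ-injective Ψ-has-outcome
  where
  separated? : Decidable (λ S → InSub π S × HorizSep S)
  separated? S = inSub? π S ×-dec horizSep? S
  separated⁻ : ∀ {S} → S ∈ filter separated? (allPairSets n) → InSub π S × HorizSep S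
  separated⁻ S∈ = proj₂ (∈-filter⁻ separated? {xs = allPairSets n} S∈)
  separated-unique : Unique (filter separated? (allPairSets n))
  separated-unique = Unique.filter⁺ separated? (allVecs-unique (allVecs-unique bits-unique n) n)
    where
    bits-unique : Unique (true ∷ false ∷ [])
    bits-unique = ((λ ()) ∷ []) ∷ [] ∷ []
  Ψ-injective : ∀ {S S′} → S ∈ filter separated? (allPairSets n) →
                S′ ∈ filter separated? (allPairSets n) → Ψ π S ≡ Ψ π S′ → S ≡ S′
  Ψ-injective S∈ S′∈ = Ψ-injective-on-Sub π (proj₁ (separated⁻ S∈)) (proj₁ (separated⁻ S′∈))
  Ψ-has-outcome : ∀ {S} → S ∈ filter separated? (allPairSets n) →
                  Ψ π S ∈ filter (λ p → hasOutcome? p π) (allPreferences n)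
  Ψ-has-outcome {S} S∈ = ∈-filter⁺ (λ p → hasOutcome? p π) (∈-allVecs ∈-allFin (Ψ π S))
    (valid S (proj₁ (separated⁻ S∈)) (proj₂ (separated⁻ S∈)))

proposition2p13 : (n : ℕ) (π : Permutation′ n) →
    ((S : PairSet n) → InSub π S → HorizSep S → Valid π S) ×
    (length (filter (λ S → inSub? π S ×-dec horizSep? S) (allPairSets n))
      ≤ length (filter (λ p → hasOutcome? p π) (allPreferences n)))
proposition2p13 n π =
  horizontally-separated⇒valid π , separated-count≤outcome-count π (horizontally-separated⇒valid π)
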